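{- If an $(m,n,w)$-domination mapping exists, then $n\ge 2m-w$.
   Context: For $y \in \{0,1\}^n$, $\mathrm{wt}(y)$ is the number of nonzero coordinates, and $\mathcal{B}(n,w)=\{y\in\{0,1\}^n : \mathrm{wt}(y)\le w\}$. A domination graph is a bipartite graph $G=([m]\cup[n],E)$ with left vertex set $[m]$ and right vertex set $[n]$ having no isolated right vertices. An injective map $\varphi:\{0,1\}^m\to\mathcal{B}(n,w)$ is $G$-dominating if for every $x\in\{0,1\}^m$ and every edge $(i,j)\in E$: $x_i=0$ implies that the $j$-th coordinate of $\varphi(x)$ is $0$. An $(m,n,w)$-domination mapping is an injective map $\{0,1\}^m\to\mathcal{B}(n,w)$ that is $G$-dominating for some domination graph $G=([m]\cup[n],E)$. -}

module Defs where

open import Data.Nat using (ℕ; _≤_)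
open import Data.Bool using (Bool; true; false)
open import Data.Fin using (Fin)
open import Data.Vec using (Vec; lookup; count)
open import Data.Product using (Σ; ∃; _×_)
open import Relation.Binary.PropositionalEquality using (_≡_)
open import Relation.Nullary using (Dec)
open import Data.Bool.Properties using () renaming (_≟_ to _≟ᵇ_)
open import Function.Definitions using (Injective)

-- binary words of length n: {0,1}^n, with 1 = true
Word : ℕ → Set
Word n = Vec Bool n

isOne : Bool → Set
isOne b = b ≡ true

isOne? : (b : Bool) → Dec (isOne b)
isOne? b = b ≟ᵇ true

wt : {n : ℕ} → Word n → ℕ
wt = count isOne?

BipGraph : ℕ → ℕ → Set
BipGraph m n = Fin m → Fin n → Bool

IsDominationGraph : {m n : ℕ} → BipGraph m n → Set
IsDominationGraph {m} {n} E = (j : Fin n) → ∃ λ (i : Fin m) → E i j ≡ true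

-- φ : {0,1}^m → B(n,w), represented as a map into words of length n
-- whose image has weight ≤ w
MapsIntoBall : {m n : ℕ} → ℕ → (Word m → Word n) → Set
MapsIntoBall w φ = ∀ x → wt (φ x) ≤ w

IsDominating : {m n : ℕ} → BipGraph m n → (Word m → Word n) → Set
IsDominating E φ = ∀ x i j → E i j ≡ true → lookup x i ≡ false → lookup (φ x) j ≡ false

IsDominationMapping : (m n w : ℕ) → (Word m → Word n) → Set
IsDominationMapping m n w φ =
  MapsIntoBall w φ × Injective _≡_ _≡_ φ ×
  Σ (BipGraph m n) (λ E → IsDominationGraph E × IsDominating E φ)

DominationMappingExists : (m n w : ℕ) → Set
DominationMappingExists m n w = Σ (Word m → Word n) (IsDominationMapping m n w)

module Submission where

-- Words of length k are read as subsets of [k] (the stdlib's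
-- Subset k is literally Vec Bool k, and the Hamming weight is its size).
-- Let φ be G-dominating and injective, and let nbr j be a chosen neighbour
-- of the right vertex j.  Then φ(∅) = ∅, so each φ({i}) is nonempty; any
-- lit vertex prv i of φ({i}) has i as its ONLY neighbour ("private"
-- vertex), hence nbr (prv i) = i and prv is injective.  Call a left vertex
-- blocked if it is the chosen neighbour of a non-private right vertex, and
-- free otherwise; there are at most n - m blocked vertices.  On subsets x
-- of the free vertices, φ(x) consists of private vertices only, so φ(x) is
-- determined by lit x = {i | prv i ∈ φ(x)} ⊆ x; an injective shrinking map
-- on the subsets of a set is the identity, so φ(Free) contains all prv i
-- with i free and  m - (n - m) ≤ #Free ≤ wt φ(Free) ≤ w.

open import Defs
open import Data.Nat using (ℕ; suc; _≤_; _<_; _+_; _*_; s≤s)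
open import Data.Nat.Properties
  using (≤-reflexive; ≤-trans; +-mono-≤; +-monoʳ-≤; +-identityʳ; +-assoc; m+[n∸m]≡n; n≤1+n; module ≤-Reasoning)
open import Data.Nat.Induction using (<-wellFounded)
open import Data.Bool using (true; false)
open import Data.Fin using (Fin; zero; suc)
open import Data.Fin.Properties using (any?; _≟_)
open import Data.Fin.Subset
  using (Subset; _∈_; _∉_; _⊆_; _⊂_; ⊥; ⊤; ⁅_⁆; ∁; _-_; ∣_∣; Nonempty; inside; outside)
open import Data.Fin.Subset.Properties
  using ( _∈?_; _⊂?_; nonempty?; Empty-unique; ∣⊥∣≡0; ∣⊤∣≡n; ∣∁p∣≡n∸∣p∣; ∣p∣≤n; ∉⊥; x∈⁅x⁆
        ; x∈⁅y⁆⇒x≡y; drop-there; p─q⊆p; p─⊥≡p; x∉p⇒x∈∁p; x∈∁p⇒x∉p; ⊆-antisym; ⊆-trans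
        ; ⊆-reflexive; p⊂q⇒∣p∣<∣q∣ )
open import Data.Vec using (_∷_; []; lookup; tabulate; there)
open import Data.Vec.Properties using (lookup∘tabulate; []=⇒lookup; lookup⇒[]=)
open import Data.Product using (∃; _×_; _,_; proj₁; proj₂)
open import Function.Definitions using (Injective)
open import Induction.WellFounded using (Acc; acc)
open import Relation.Nullary using (yes; no; ¬_; contradiction; does)
open import Relation.Nullary.Decidable using (dec-true; ¬?; _×-dec_)
open import Relation.Unary using (Pred; Decidable)
open import Relation.Binary.PropositionalEquality using (_≡_; refl; sym; trans; cong; subst)

⟦_⟧ : ∀ {k ℓ} {P : Pred (Fin k) ℓ} → Decidable P → Subset k
⟦ P? ⟧ = tabulate (λ i → does (P? i))

∈⟦⟧⁺ : ∀ {k ℓ} {P : Pred (Fin k) ℓ} (P? : Decidable P) {i : Fin k} → P i → i ∈ ⟦ P? ⟧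
∈⟦⟧⁺ P? {i} Pi = lookup⇒[]= i _ (trans (lookup∘tabulate _ i) (dec-true (P? i) Pi))

∈⟦⟧⁻ : ∀ {k ℓ} {P : Pred (Fin k) ℓ} (P? : Decidable P) {i : Fin k} → i ∈ ⟦ P? ⟧ → P i
∈⟦⟧⁻ P? {i} i∈ with P? i | trans (sym (lookup∘tabulate _ i)) ([]=⇒lookup i∈)
... | yes Pi | _  = Pi
... | no  _  | ()

∣p∣+∣∁p∣≡k : ∀ {k} (p : Subset k) → ∣ p ∣ + ∣ ∁ p ∣ ≡ k
∣p∣+∣∁p∣≡k p = trans (cong (∣ p ∣ +_) (∣∁p∣≡n∸∣p∣ p)) (m+[n∸m]≡n (∣p∣≤n p))

∣p∣≤1+∣p-x∣ : ∀ {k} (p : Subset k) (x : Fin k) → ∣ p ∣ ≤ suc ∣ p - x ∣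
∣p∣≤1+∣p-x∣ (inside  ∷ p) zero    = s≤s (≤-reflexive (sym (cong ∣_∣ (p─⊥≡p p))))
∣p∣≤1+∣p-x∣ (outside ∷ p) zero    = ≤-trans (≤-reflexive (sym (cong ∣_∣ (p─⊥≡p p)))) (n≤1+n _)
∣p∣≤1+∣p-x∣ (inside  ∷ p) (suc x) = s≤s (∣p∣≤1+∣p-x∣ p x)
∣p∣≤1+∣p-x∣ (outside ∷ p) (suc x) = ∣p∣≤1+∣p-x∣ p x

x∉p-x : ∀ {k} (p : Subset k) (x : Fin k) → x ∉ p - x
x∉p-x (_ ∷ p) zero    ()
x∉p-x (_ ∷ p) (suc x) (there x∈) = x∉p-x p x x∈

-- If every element of q is the image under g of an element of p, then q is
-- no larger than p.  (Induction on the domain: the first point of p covers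
-- at most the one point g zero of q.)
cover-≤ : ∀ {k l} (g : Fin k → Fin l) (p : Subset k) (q : Subset l) →
          (∀ {i} → i ∈ q → ∃ λ j → j ∈ p × g j ≡ i) → ∣ q ∣ ≤ ∣ p ∣
cover-≤ {l = l} g [] q covers =
  ≤-reflexive (trans (cong ∣_∣ (Empty-unique λ { (i , i∈q) → noPreimage (covers i∈q) })) (∣⊥∣≡0 l))
  where
    noPreimage : ∀ {i} → ¬ ∃ λ (j : Fin 0) → j ∈ [] × g j ≡ i
    noPreimage (() , _)
cover-≤ g (outside ∷ p) q covers = cover-≤ (λ j → g (suc j)) p q covers′
  where
    covers′ : ∀ {i} → i ∈ q → ∃ λ j → j ∈ p × g (suc j) ≡ i
    covers′ i∈q with covers i∈q
    ... | suc j , j∈ , gj≡i = j , drop-there j∈ , gj≡i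
cover-≤ g (inside ∷ p) q covers =
  ≤-trans (∣p∣≤1+∣p-x∣ q (g zero)) (s≤s (cover-≤ (λ j → g (suc j)) p (q - g zero) covers′))
  where
    covers′ : ∀ {i} → i ∈ q - g zero → ∃ λ j → j ∈ p × g (suc j) ≡ i
    covers′ {i} i∈q-g0 with covers (p─q⊆p q ⁅ g zero ⁆ i∈q-g0)
    ... | zero  , _  , g0≡i = contradiction (subst (_∈ q - g zero) (sym g0≡i) i∈q-g0) (x∉p-x q (g zero))
    ... | suc j , j∈ , gj≡i = j , drop-there j∈ , gj≡i

⊆∧⊄⇒≡ : ∀ {k} {p q : Subset k} → p ⊆ q → ¬ p ⊂ q → p ≡ q
⊆∧⊄⇒≡ {p = p} {q} p⊆q p⊄q = ⊆-antisym p⊆q q⊆p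
  where
    q⊆p : q ⊆ p
    q⊆p {x} x∈q with x ∈? p
    ... | yes x∈p = x∈p
    ... | no  x∉p = contradiction ((λ {y} → p⊆q {y}) , x , x∈q , x∉p) p⊄q

-- A map that shrinks every subset of S and is injective on them fixes
-- every subset of S.  By induction on size: if f x ⊂ x then f fixes f x,
-- so f (f x) ≡ f x and injectivity forces f x ≡ x.
shrinking-injection-fixes : ∀ {k} (S : Subset k) (f : Subset k → Subset k) →
  (∀ {x} → x ⊆ S → f x ⊆ x) →
  (∀ {x y} → x ⊆ S → y ⊆ S → f x ≡ f y → x ≡ y) →
  ∀ {x} → x ⊆ S → f x ≡ x
shrinking-injection-fixes S f shrinks injective {x} = fixes x (<-wellFounded ∣ x ∣)
  where
    fixes : ∀ x → Acc _<_ ∣ x ∣ → x ⊆ S → f x ≡ x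
    fixes x (acc smaller) x⊆S with f x ⊂? x
    ... | no  fx⊄x = ⊆∧⊄⇒≡ (shrinks x⊆S) fx⊄x
    ... | yes fx⊂x = injective fx⊆S x⊆S (fixes (f x) (smaller (p⊂q⇒∣p∣<∣q∣ fx⊂x)) fx⊆S)
      where
        fx⊆S : f x ⊆ S
        fx⊆S = ⊆-trans (shrinks x⊆S) x⊆S

module DominatingInjection {m n : ℕ} (φ : Word m → Word n) (injective : Injective _≡_ _≡_ φ)
                           (E : BipGraph m n) (noIsolated : IsDominationGraph E)
                           (dominating : IsDominating E φ) where

  nbr : Fin n → Fin m
  nbr j = proj₁ (noIsolated j)

  nbr-edge : ∀ j → E (nbr j) j ≡ true
  nbr-edge j = proj₂ (noIsolated j)

  lit⇒nbr-lit : ∀ {x i j} → E i j ≡ true → j ∈ φ x → i ∈ x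
  lit⇒nbr-lit {x} {i} {j} edge j∈φx with lookup x i in xᵢ
  ... | true  = lookup⇒[]= i x xᵢ
  ... | false = contradiction (trans (sym ([]=⇒lookup j∈φx)) (dominating x i j edge xᵢ)) λ ()

  -- Every right vertex has a neighbour, so the empty word maps to the empty word.
  φ⊥≡⊥ : φ ⊥ ≡ ⊥
  φ⊥≡⊥ = Empty-unique λ { (j , j∈φ⊥) → ∉⊥ (lit⇒nbr-lit (nbr-edge j) j∈φ⊥) }

  -- By injectivity, the image of a singleton is nonempty.
  φ⁅i⁆-nonempty : ∀ i → Nonempty (φ ⁅ i ⁆)
  φ⁅i⁆-nonempty i with nonempty? (φ ⁅ i ⁆)
  ... | yes nonempty = nonempty
  ... | no  empty    = contradiction (subst (i ∈_) ⁅i⁆≡⊥ (x∈⁅x⁆ i)) ∉⊥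
    where
      ⁅i⁆≡⊥ : ⁅ i ⁆ ≡ ⊥
      ⁅i⁆≡⊥ = injective (trans (Empty-unique empty) (sym φ⊥≡⊥))

  -- A private right vertex of i: lit by φ ⁅ i ⁆, hence adjacent to i only.
  prv : Fin m → Fin n
  prv i = proj₁ (φ⁅i⁆-nonempty i)

  prv-only-nbr : ∀ {i i′} → E i′ (prv i) ≡ true → i′ ≡ i
  prv-only-nbr {i} edge = x∈⁅y⁆⇒x≡y i (lit⇒nbr-lit edge (proj₂ (φ⁅i⁆-nonempty i)))

  nbr∘prv : ∀ i → nbr (prv i) ≡ i
  nbr∘prv i = prv-only-nbr (nbr-edge (prv i))

  prv-edge : ∀ i → E i (prv i) ≡ true
  prv-edge i = subst (λ i′ → E i′ (prv i) ≡ true) (nbr∘prv i) (nbr-edge (prv i))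

  Private : Subset n
  Private = ⟦ (λ j → prv (nbr j) ≟ j) ⟧

  blocked? : Decidable (λ i → ∃ λ j → j ∉ Private × nbr j ≡ i)
  blocked? i = any? (λ j → ¬? (j ∈? Private) ×-dec (nbr j ≟ i))

  Blocked Free : Subset m
  Blocked = ⟦ blocked? ⟧
  Free    = ∁ Blocked

  prv∈Private : ∀ i → prv i ∈ Private
  prv∈Private i = ∈⟦⟧⁺ (λ j → prv (nbr j) ≟ j) (cong prv (nbr∘prv i))

  φ-private : ∀ {x} → x ⊆ Free → φ x ⊆ Private
  φ-private {x} x⊆Free {j} j∈φx with j ∈? Private
  ... | yes j∈Private = j∈Private
  ... | no  j∉Private =
    contradiction (∈⟦⟧⁺ blocked? (j , j∉Private , refl)) (x∈∁p⇒x∉p (x⊆Free (lit⇒nbr-lit (nbr-edge j) j∈φx)))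

  lit : Word m → Word m
  lit x = ⟦ (λ i → prv i ∈? φ x) ⟧

  lit-shrinks : ∀ {x} → lit x ⊆ x
  lit-shrinks {x} i∈ = lit⇒nbr-lit (prv-edge _) (∈⟦⟧⁻ (λ i → prv i ∈? φ x) i∈)

  lit-monotone⇒φ-monotone : ∀ {x y} → x ⊆ Free → lit x ⊆ lit y → φ x ⊆ φ y
  lit-monotone⇒φ-monotone {x} {y} x⊆Free litx⊆lity {j} j∈φx =
    subst (_∈ φ y) prv∘nbr≡j (∈⟦⟧⁻ (λ i → prv i ∈? φ y) (litx⊆lity nbr-j∈litx))
    where
      prv∘nbr≡j : prv (nbr j) ≡ j
      prv∘nbr≡j = ∈⟦⟧⁻ (λ j → prv (nbr j) ≟ j) (φ-private x⊆Free j∈φx)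
      nbr-j∈litx : nbr j ∈ lit x
      nbr-j∈litx = ∈⟦⟧⁺ (λ i → prv i ∈? φ x) (subst (_∈ φ x) (sym prv∘nbr≡j) j∈φx)

  lit-injective : ∀ {x y} → x ⊆ Free → y ⊆ Free → lit x ≡ lit y → x ≡ y
  lit-injective x⊆Free y⊆Free litx≡lity = injective (⊆-antisym
    (lit-monotone⇒φ-monotone x⊆Free (⊆-reflexive litx≡lity))
    (lit-monotone⇒φ-monotone y⊆Free (⊆-reflexive (sym litx≡lity))))

  prv-Free-lit : ∀ {i} → i ∈ Free → prv i ∈ φ Free
  prv-Free-lit i∈Free =
    ∈⟦⟧⁻ (λ i → prv i ∈? φ Free)
         (subst (_ ∈_) (sym (shrinking-injection-fixes Free lit (λ _ → lit-shrinks) lit-injective (λ x → x))) i∈Free)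

  m≤∣Private∣ : m ≤ ∣ Private ∣
  m≤∣Private∣ = subst (_≤ ∣ Private ∣) (∣⊤∣≡n m)
    (cover-≤ nbr Private ⊤ λ {i} _ → prv i , prv∈Private i , nbr∘prv i)

  ∣Blocked∣≤∣∁Private∣ : ∣ Blocked ∣ ≤ ∣ ∁ Private ∣
  ∣Blocked∣≤∣∁Private∣ = cover-≤ nbr (∁ Private) Blocked λ i∈Blocked →
    let (j , j∉Private , nbrj≡i) = ∈⟦⟧⁻ blocked? i∈Blocked in j , x∉p⇒x∈∁p j∉Private , nbrj≡i

  ∣Free∣≤wt : ∣ Free ∣ ≤ wt (φ Free)
  ∣Free∣≤wt = cover-≤ nbr (φ Free) Free λ {i} i∈Free → prv i , prv-Free-lit i∈Free , nbr∘prv i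

  2m≤n+wt : 2 * m ≤ n + wt (φ Free)
  2m≤n+wt = begin
    2 * m                                            ≡⟨ cong (m +_) (+-identityʳ m) ⟩
    m + m                                            ≡⟨ cong (m +_) (sym (∣p∣+∣∁p∣≡k Blocked)) ⟩
    m + (∣ Blocked ∣ + ∣ Free ∣)                     ≤⟨ +-mono-≤ m≤∣Private∣ (+-mono-≤ ∣Blocked∣≤∣∁Private∣ ∣Free∣≤wt) ⟩
    ∣ Private ∣ + (∣ ∁ Private ∣ + wt (φ Free))      ≡⟨ sym (+-assoc ∣ Private ∣ _ _) ⟩
    ∣ Private ∣ + ∣ ∁ Private ∣ + wt (φ Free)        ≡⟨ cong (_+ wt (φ Free)) (∣p∣+∣∁p∣≡k Private) ⟩
    n + wt (φ Free)                                  ∎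
    where open ≤-Reasoning

lemma7 : (m n w : ℕ) → DominationMappingExists m n w → 2 * m ≤ n + w
lemma7 m n w (φ , ball , injective , E , noIsolated , dominating) =
  ≤-trans 2m≤n+wt (+-monoʳ-≤ n (ball Free))
  where open DominatingInjection φ injective E noIsolated dominating
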